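{- Let $\vdash\ \subseteq\wp(Form)\times Form$ satisfy (A), (Cut), (Mon), (Com), ($\bot$), (PC), (MP), (DT). Let $\Gamma,\Delta,\Theta\subseteq Form$ all be $\vdash$-closed. Then the following are equivalent: (i) $\{\neg\alpha\to\beta : \alpha\in\Gamma,\ \beta\in\Delta\}\subseteq\Theta$; (ii) for every $\Theta'\in W^c_{\vdash}$ with $\Theta\subseteq\Theta'$, either $\Gamma\cup\Theta'$ is $\vdash$-consistent or $\Delta\subseteq\Theta'$; (iii) for every $\Theta'\in W^c_{\vdash}$ with $\Theta\subseteq\Theta'$, either there exists $\Psi\in W^c_{\vdash}$ with $\Gamma\cup\Theta'\subseteq\Psi$, or $\Delta\subseteq\Theta'$.
   Context: $Form$ is the set of formulas built from countably many propositional variables and $\bot$ with $\land,\lor,\to$; $\neg\alpha$ abbreviates $\alpha\to\bot$. Properties of $\vdash$ (for all $\Gamma,\Delta,\varphi,\psi,\chi$): (A) $\Gamma\cup\{\varphi\}\vdash\varphi$; (Cut) if $\Gamma\cup\{\psi\}\vdash\varphi$ and $\Delta\vdash\psi$ then $\Gamma\cup\Delta\vdash\varphi$; (Mon) if $\Gamma\vdash\varphi$ and $\Gamma\subseteq\Delta$ then $\Delta\vdash\varphi$; (Com) if $\Gamma\vdash\varphi$ then $\Gamma'\vdash\varphi$ for some finite $\Gamma'\subseteq\Gamma$; ($\bot$) $\{\bot\}\vdash\varphi$; (PC) if $\Gamma\cup\{\varphi\}\vdash\chi$ and $\Gamma\cup\{\psi\}\vdash\chi$ then $\Gamma\cup\{\varphi\lor\psi\}\vdash\chi$;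 (MP) $\{\varphi,\varphi\to\psi\}\vdash\psi$; (DT) if $\Gamma\cup\{\varphi\}\vdash\psi$ then $\Gamma\vdash\varphi\to\psi$. A set $\Gamma$ is $\vdash$-closed if $\Gamma\vdash\varphi$ implies $\varphi\in\Gamma$; $\vdash$-consistent if $\Gamma\nvdash\bot$; disjunction complete if $\varphi\lor\psi\in\Gamma$ implies $\varphi\in\Gamma$ or $\psi\in\Gamma$. $W^c_{\vdash}$ is the set of all $\vdash$-consistent, $\vdash$-closed, disjunction complete sets of formulas. -}

module Defs where

open import Data.Nat using (ℕ)
open import Data.Product using (Σ; ∃; _×_)
open import Data.Sum using (_⊎_)
open import Data.List using (List)
open import Data.List.Relation.Unary.All using (All)
import Data.List.Membership.Propositional as LMem
open import Level using (0ℓ)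
open import Relation.Nullary using (¬_)
open import Relation.Unary using (Pred; _∈_; _⊆_; _∪_; ｛_｝)

data Form : Set where
  var  : ℕ → Form
  ⊥f   : Form
  _∧f_ : Form → Form → Form
  _∨f_ : Form → Form → Form
  _⇒_  : Form → Form → Form

infixr 5 _⇒_

¬f : Form → Form
¬f α = α ⇒ ⊥f

FSet : Set₁
FSet = Pred Form 0ℓ

listSet : List Form → FSet
listSet xs = λ φ → φ LMem.∈ xs

Consequence : Set₁
Consequence = FSet → Form → Set

record Properties (_⊢_ : Consequence) : Set₁ where
  field
    A   : ∀ Γ φ → (Γ ∪ ｛ φ ｝) ⊢ φ
    Cut : ∀ Γ Δ φ ψ → (Γ ∪ ｛ ψ ｝) ⊢ φ → Δ ⊢ ψ → (Γ ∪ Δ) ⊢ φ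
    Mon : ∀ Γ Δ φ → Γ ⊢ φ → Γ ⊆ Δ → Δ ⊢ φ
    Com : ∀ Γ φ → Γ ⊢ φ → Σ (List Form) (λ Γ' → All (_∈ Γ) Γ' × listSet Γ' ⊢ φ)
    Bot : ∀ φ → ｛ ⊥f ｝ ⊢ φ
    PC  : ∀ Γ φ ψ χ → (Γ ∪ ｛ φ ｝) ⊢ χ → (Γ ∪ ｛ ψ ｝) ⊢ χ → (Γ ∪ ｛ φ ∨f ψ ｝) ⊢ χ
    MP  : ∀ φ ψ → (｛ φ ｝ ∪ ｛ φ ⇒ ψ ｝) ⊢ ψ
    DT  : ∀ Γ φ ψ → (Γ ∪ ｛ φ ｝) ⊢ ψ → Γ ⊢ (φ ⇒ ψ)

module _ (_⊢_ : Consequence) where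

  Closed : FSet → Set
  Closed Γ = ∀ φ → Γ ⊢ φ → φ ∈ Γ

  Consistent : FSet → Set
  Consistent Γ = ¬ (Γ ⊢ ⊥f)

  DisjComplete : FSet → Set
  DisjComplete Γ = ∀ φ ψ → (φ ∨f ψ) ∈ Γ → φ ∈ Γ ⊎ ψ ∈ Γ

  record Wc (Γ : FSet) : Set where
    field
      consistent   : Consistent Γ
      closed       : Closed Γ
      disjComplete : DisjComplete Γ

  CondI : FSet → FSet → FSet → Set
  CondI Γ Δ Θ = ∀ α β → α ∈ Γ → β ∈ Δ → (¬f α ⇒ β) ∈ Θ

  CondII : FSet → FSet → FSet → Set₁
  CondII Γ Δ Θ = ∀ (Θ' : FSet) → Wc Θ' → Θ ⊆ Θ' → Consistent (Γ ∪ Θ') ⊎ Δ ⊆ Θ'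

  CondIII : FSet → FSet → FSet → Set₁
  CondIII Γ Δ Θ = ∀ (Θ' : FSet) → Wc Θ' → Θ ⊆ Θ' →
    Σ FSet (λ Ψ → Wc Ψ × (Γ ∪ Θ') ⊆ Ψ) ⊎ Δ ⊆ Θ'

{-# OPTIONS --safe #-}
-- (i) ⇒ (ii): if Γ ∪ Θ' is inconsistent, compactness and the closedness of Γ yield a single
-- α ∈ Γ with Θ' ⊢ ¬α, so every β ∈ Δ follows from ¬α → β ∈ Θ'. The other directions rest on
-- Lindenbaum's lemma: with excluded middle and an injective coding of formulas by naturals,
-- a set not deriving χ extends to a member of W^c not deriving χ. If ¬α → β ∉ Θ, such an
-- extension of Θ ∪ {¬α} avoiding β contradicts (ii); and a set is consistent exactly when
-- it has an extension in W^c, which turns (ii) into (iii).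
module Submission where

open import Defs
open import Data.Product using (_×_)
open import Level using (0ℓ)
open import Axiom.ExcludedMiddle using (ExcludedMiddle)
open import Function.Bundles using (_⇔_)

open import Axiom.DoubleNegationElimination using (em⇒dne)
open import Data.Empty using (⊥-elim)
open import Data.List using ([]; _∷_)
open import Data.List.Relation.Unary.All using (All; []; _∷_)
open import Data.List.Relation.Unary.Any using (here; there)
open import Data.Nat using (ℕ; zero; suc; _+_; _⊔_; _≤_; _<_; z≤n; s≤s; _≤′_; ≤′-refl; ≤′-step)
open import Data.Nat.Properties
  using (+-comm; +-cancelˡ-≡; +-mono-≤; +-monoʳ-≤; m≤m+n; n<1+n; <-cmp; <-irrefl; m≤m⊔n; m≤n⊔m; ≤⇒≤′; module ≤-Reasoning)
open import Data.Product using (Σ; ∃-syntax; _,_; proj₁; map₂)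
open import Data.Sum using (_⊎_; inj₁; inj₂; map₁)
open import Function using (id; _∘_)
open import Function.Bundles using (_↣_; mk↣; mk⇔; Injection; Equivalence)
open import Function.Definitions using (Injective)
open import Relation.Binary.Definitions using (tri<; tri≈; tri>)
open import Relation.Binary.PropositionalEquality using (_≡_; refl; sym; trans; cong; subst)
open import Relation.Nullary using (¬_; yes; no)
open import Relation.Unary using (_∈_; _⊆_; _∪_; ｛_｝)

private
  variable
    a b c d m n : ℕ
    φ ψ χ : Form
    Γ Δ Θ S T : FSet

triangle : ℕ → ℕ
triangle zero    = zero
triangle (suc n) = suc n + triangle n

triangle-mono-≤ : m ≤ n → triangle m ≤ triangle n
triangle-mono-≤ z≤n       = z≤n
triangle-mono-≤ (s≤s m≤n) = +-mono-≤ (s≤s m≤n) (triangle-mono-≤ m≤n)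

cantor : ℕ → ℕ → ℕ
cantor a b = triangle (a + b) + a

cantor<triangle : ∀ a b → cantor a b < triangle (suc (a + b))
cantor<triangle a b = begin-strict
  triangle (a + b) + a       ≤⟨ +-monoʳ-≤ (triangle (a + b)) (m≤m+n a b) ⟩
  triangle (a + b) + (a + b) ≡⟨ +-comm (triangle (a + b)) (a + b) ⟩
  (a + b) + triangle (a + b) <⟨ n<1+n _ ⟩
  triangle (suc (a + b))     ∎
  where open ≤-Reasoning

cantor-mono-< : ∀ a b c d → a + b < c + d → cantor a b < cantor c d
cantor-mono-< a b c d a+b<c+d = begin-strict
  cantor a b             <⟨ cantor<triangle a b ⟩
  triangle (suc (a + b)) ≤⟨ triangle-mono-≤ a+b<c+d ⟩
  triangle (c + d)       ≤⟨ m≤m+n (triangle (c + d)) c ⟩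
  cantor c d             ∎
  where open ≤-Reasoning

cantor-injective-sum : cantor a b ≡ cantor c d → a + b ≡ c + d
cantor-injective-sum {a} {b} {c} {d} eq with <-cmp (a + b) (c + d)
... | tri< lt _ _ = ⊥-elim (<-irrefl eq (cantor-mono-< a b c d lt))
... | tri≈ _ e _  = e
... | tri> _ _ gt = ⊥-elim (<-irrefl (sym eq) (cantor-mono-< c d a b gt))

cantor-injective : cantor a b ≡ cantor c d → a ≡ c × b ≡ d
cantor-injective {a} {b} {c} {d} eq = a≡c , +-cancelˡ-≡ a b d (trans sum≡ (cong (_+ d) (sym a≡c)))
  where
  sum≡ : a + b ≡ c + d
  sum≡ = cantor-injective-sum {a} {b} {c} {d} eq
  a≡c : a ≡ c
  a≡c = +-cancelˡ-≡ (triangle (c + d)) a c (subst (λ s → triangle s + a ≡ cantor c d) sum≡ eq)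

tag : Form → ℕ
tag (var _)  = 0
tag ⊥f       = 1
tag (_ ∧f _) = 2
tag (_ ∨f _) = 3
tag (_ ⇒ _)  = 4

code : Form → ℕ
payload : Form → ℕ
code φ = cantor (tag φ) (payload φ)
payload (var n)  = n
payload ⊥f       = 0
payload (φ ∧f ψ) = cantor (code φ) (code ψ)
payload (φ ∨f ψ) = cantor (code φ) (code ψ)
payload (φ ⇒ ψ)  = cantor (code φ) (code ψ)

code-injective : Injective _≡_ _≡_ code
payload-injective : ∀ φ ψ → tag φ ≡ tag ψ → payload φ ≡ payload ψ → φ ≡ ψ
children-injective : ∀ {φ φ′ ψ ψ′} →
  cantor (code φ) (code φ′) ≡ cantor (code ψ) (code ψ′) → φ ≡ ψ × φ′ ≡ ψ′

code-injective {φ} {ψ} eq with cantor-injective {tag φ} {payload φ} {tag ψ} {payload ψ} eq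
... | tag≡ , payload≡ = payload-injective φ ψ tag≡ payload≡

children-injective {φ} {φ′} {ψ} {ψ′} eq
  with cantor-injective {code φ} {code φ′} {code ψ} {code ψ′} eq
... | eq₁ , eq₂ = code-injective eq₁ , code-injective eq₂

payload-injective (var m)  (var n)  _ m≡n = cong var m≡n
payload-injective ⊥f       ⊥f       _ _   = refl
payload-injective (φ ∧f φ′) (ψ ∧f ψ′) _ eq with children-injective {φ} {φ′} {ψ} {ψ′} eq
... | refl , refl = refl
payload-injective (φ ∨f φ′) (ψ ∨f ψ′) _ eq with children-injective {φ} {φ′} {ψ} {ψ′} eq
... | refl , refl = refl
payload-injective (φ ⇒ φ′)  (ψ ⇒ ψ′)  _ eq with children-injective {φ} {φ′} {ψ} {ψ′} eq
... | refl , refl = refl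
payload-injective (var _)  ⊥f       () _
payload-injective (var _)  (_ ∧f _) () _
payload-injective (var _)  (_ ∨f _) () _
payload-injective (var _)  (_ ⇒ _)  () _
payload-injective ⊥f       (var _)  () _
payload-injective ⊥f       (_ ∧f _) () _
payload-injective ⊥f       (_ ∨f _) () _
payload-injective ⊥f       (_ ⇒ _)  () _
payload-injective (_ ∧f _) (var _)  () _
payload-injective (_ ∧f _) ⊥f       () _
payload-injective (_ ∧f _) (_ ∨f _) () _
payload-injective (_ ∧f _) (_ ⇒ _)  () _
payload-injective (_ ∨f _) (var _)  () _
payload-injective (_ ∨f _) ⊥f       () _
payload-injective (_ ∨f _) (_ ∧f _) () _
payload-injective (_ ∨f _) (_ ⇒ _)  () _
payload-injective (_ ⇒ _)  (var _)  () _
payload-injective (_ ⇒ _)  ⊥f       () _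
payload-injective (_ ⇒ _)  (_ ∧f _) () _
payload-injective (_ ⇒ _)  (_ ∨f _) () _

Form↣ℕ : Form ↣ ℕ
Form↣ℕ = mk↣ code-injective

module Derivations {_⊢_ : Consequence} (P : Properties _⊢_) where
  open Properties P using (A; Cut; Mon; Com; Bot; MP; DT)

  mono : Γ ⊢ φ → Γ ⊆ Δ → Δ ⊢ φ
  mono = Mon _ _ _

  assumption : φ ∈ Γ → Γ ⊢ φ
  assumption φ∈Γ = mono (A _ _) λ { (inj₁ p) → p ; (inj₂ refl) → φ∈Γ }

  cut : (Γ ∪ ｛ ψ ｝) ⊢ φ → Γ ⊢ ψ → Γ ⊢ φ
  cut ⊢φ ⊢ψ = mono (Cut _ _ _ _ ⊢φ ⊢ψ) λ { (inj₁ p) → p ; (inj₂ p) → p }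

  deduction : (Γ ∪ ｛ φ ｝) ⊢ ψ → Γ ⊢ (φ ⇒ ψ)
  deduction = DT _ _ _

  modus-ponens : Γ ⊢ φ → Γ ⊢ (φ ⇒ ψ) → Γ ⊢ ψ
  modus-ponens {Γ} {φ} {ψ} ⊢φ ⊢φ⇒ψ = cut (cut (mono (MP φ ψ) MP-premises) (mono ⊢φ⇒ψ inj₁)) ⊢φ
    where
    MP-premises : (｛ φ ｝ ∪ ｛ φ ⇒ ψ ｝) ⊆ ((Γ ∪ ｛ φ ｝) ∪ ｛ φ ⇒ ψ ｝)
    MP-premises (inj₁ p) = inj₁ (inj₂ p)
    MP-premises (inj₂ p) = inj₂ p

  explosion : Γ ⊢ ⊥f → Γ ⊢ φ
  explosion = cut (mono (Bot _) inj₂)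

  ⇒-refl : Γ ⊢ (φ ⇒ φ)
  ⇒-refl = deduction (assumption (inj₂ refl))

  ⇒-apply : Γ ⊢ φ → Γ ⊢ ((φ ⇒ ψ) ⇒ ψ)
  ⇒-apply ⊢φ = deduction (modus-ponens (mono ⊢φ inj₁) (assumption (inj₂ refl)))

  -- Lacking conjunction, the premises α and φ are merged into (α ⇒ φ ⇒ χ) ⇒ χ,
  -- which lies in Γ and yields χ over T.
  absorb-premises : Closed _⊢_ Γ → ∀ L → All (_∈ Γ ∪ T) L →
                    (T ∪ listSet L) ⊢ χ → ∃[ α ] α ∈ Γ × T ⊢ (α ⇒ χ)
  absorb-premises Γ-closed [] [] ⊢χ =
    ⊥f ⇒ ⊥f , Γ-closed _ ⇒-refl , deduction (mono ⊢χ λ { (inj₁ p) → inj₁ p })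
  absorb-premises Γ-closed (φ ∷ L) (inj₂ φ∈T ∷ L⊆) ⊢χ =
    absorb-premises Γ-closed L L⊆
      (mono ⊢χ λ { (inj₁ p) → inj₁ p ; (inj₂ (here refl)) → inj₁ φ∈T ; (inj₂ (there p)) → inj₂ p })
  absorb-premises {Γ = Γ} {χ = χ} Γ-closed (φ ∷ L) (inj₁ φ∈Γ ∷ L⊆) ⊢χ
    with absorb-premises Γ-closed L L⊆ (deduction (mono ⊢χ λ
           { (inj₁ p) → inj₁ (inj₁ p) ; (inj₂ (here refl)) → inj₂ refl ; (inj₂ (there p)) → inj₁ (inj₂ p) }))
  ... | α , α∈Γ , ⊢α⇒φ⇒χ = (α ⇒ φ ⇒ χ) ⇒ χ , Γ-closed _ Γ⊢α′ , ⇒-apply ⊢α⇒φ⇒χ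
    where
    Γ⊢α′ : Γ ⊢ ((α ⇒ φ ⇒ χ) ⇒ χ)
    Γ⊢α′ = deduction (modus-ponens (assumption (inj₁ φ∈Γ))
                        (modus-ponens (assumption (inj₁ α∈Γ)) (assumption (inj₂ refl))))

  closed-premises : Closed _⊢_ Γ → (Γ ∪ T) ⊢ χ → ∃[ α ] α ∈ Γ × T ⊢ (α ⇒ χ)
  closed-premises Γ-closed ⊢χ with Com _ _ ⊢χ
  ... | L , L⊆ , L⊢χ = absorb-premises Γ-closed L L⊆ (mono L⊢χ inj₂)

module Lindenbaum (em : ExcludedMiddle 0ℓ) {_⊢_ : Consequence} (P : Properties _⊢_)
                  (coding : Form ↣ ℕ) where
  open Properties P using (Com; PC)
  open Derivations P
  open Injection coding using (injective) renaming (to to index)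

  module Construction (S : FSet) (χ : Form) (S⊬χ : ¬ S ⊢ χ) where

    stage : ℕ → FSet
    stage zero    = S
    stage (suc n) ψ = stage n ψ ⊎ (index ψ ≡ n × ¬ (stage n ∪ ｛ ψ ｝) ⊢ χ)

    limit : FSet
    limit φ = ∃[ n ] stage n φ

    stage-mono : m ≤′ n → stage m ⊆ stage n
    stage-mono ≤′-refl        = id
    stage-mono (≤′-step m≤′n) = inj₁ ∘ stage-mono m≤′n

    finite⊆stage : ∀ L → All (_∈ limit) L → ∃[ N ] listSet L ⊆ stage N
    finite⊆stage []      []                  = 0 , λ ()
    finite⊆stage (φ ∷ L) ((n , φ∈) ∷ L⊆) with finite⊆stage L L⊆
    ... | N , L⊆N = n ⊔ N , λ
      { (here refl) → stage-mono (≤⇒≤′ (m≤m⊔n n N)) φ∈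
      ; (there p)   → stage-mono (≤⇒≤′ (m≤n⊔m n N)) (L⊆N p)
      }

    -- Since the index is injective, at most one formula enters at each stage.
    stage⊬χ : ∀ n → ¬ stage n ⊢ χ
    stage⊬χ zero = S⊬χ
    stage⊬χ (suc n) ⊢χ with em {∃[ ψ ] index ψ ≡ n × ¬ (stage n ∪ ｛ ψ ｝) ⊢ χ}
    ... | no nothing-added =
      stage⊬χ n (mono ⊢χ λ { (inj₁ p) → p ; (inj₂ added) → ⊥-elim (nothing-added (_ , added)) })
    ... | yes (ψ , index≡n , ψ⊬χ) =
      ψ⊬χ (mono ⊢χ λ
        { (inj₁ p)               → inj₁ p
        ; (inj₂ (index≡n′ , _)) → inj₂ (injective (trans index≡n (sym index≡n′)))
        })

    limit⊬χ : ¬ limit ⊢ χ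
    limit⊬χ ⊢χ with Com _ _ ⊢χ
    ... | L , L⊆ , L⊢χ with finite⊆stage L L⊆
    ... | N , L⊆N = stage⊬χ N (mono L⊢χ L⊆N)

    limit-maximal : ¬ φ ∈ limit → (limit ∪ ｛ φ ｝) ⊢ χ
    limit-maximal {φ} φ∉ with em {(stage (index φ) ∪ ｛ φ ｝) ⊢ χ}
    ... | yes ⊢χ = mono ⊢χ λ { (inj₁ p) → inj₁ (index φ , p) ; (inj₂ p) → inj₂ p }
    ... | no ⊬χ  = ⊥-elim (φ∉ (suc (index φ) , inj₂ (refl , ⊬χ)))

    limit-closed : Closed _⊢_ limit
    limit-closed φ ⊢φ with em {φ ∈ limit}
    ... | yes φ∈ = φ∈
    ... | no φ∉  = ⊥-elim (limit⊬χ (cut (limit-maximal φ∉) ⊢φ))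

    limit-disjComplete : DisjComplete _⊢_ limit
    limit-disjComplete φ ψ φ∨ψ∈ with em {φ ∈ limit} | em {ψ ∈ limit}
    ... | yes φ∈ | _      = inj₁ φ∈
    ... | no _   | yes ψ∈ = inj₂ ψ∈
    ... | no φ∉  | no ψ∉  =
      ⊥-elim (limit⊬χ (cut (PC _ φ ψ χ (limit-maximal φ∉) (limit-maximal ψ∉)) (assumption φ∨ψ∈)))

    limit-Wc : Wc _⊢_ limit
    limit-Wc = record
      { consistent   = limit⊬χ ∘ explosion
      ; closed       = limit-closed
      ; disjComplete = limit-disjComplete
      }

  prime-extension : ¬ S ⊢ χ → Σ FSet λ Ψ → Wc _⊢_ Ψ × S ⊆ Ψ × ¬ Ψ ⊢ χ
  prime-extension {S} {χ} S⊬χ = limit , limit-Wc , (0 ,_) , limit⊬χ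
    where open Construction S χ S⊬χ

  consistent⇔prime-extension : Consistent _⊢_ S ⇔ Σ FSet λ Ψ → Wc _⊢_ Ψ × S ⊆ Ψ
  consistent⇔prime-extension = mk⇔
    (map₂ (map₂ proj₁) ∘ prime-extension)
    (λ { (Ψ , Ψ-Wc , S⊆Ψ) S⊢⊥ → Wc.consistent Ψ-Wc (mono S⊢⊥ S⊆Ψ) })

module Conditions (em : ExcludedMiddle 0ℓ) {_⊢_ : Consequence} (P : Properties _⊢_) where
  open Derivations P
  open Lindenbaum em P Form↣ℕ

  I⇒II : Closed _⊢_ Γ → CondI _⊢_ Γ Δ Θ → CondII _⊢_ Γ Δ Θ
  I⇒II {Γ} Γ-closed I T T-Wc Θ⊆T with em {(Γ ∪ T) ⊢ ⊥f}
  ... | no Γ∪T⊬⊥ = inj₁ Γ∪T⊬⊥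
  ... | yes Γ∪T⊢⊥ with closed-premises Γ-closed Γ∪T⊢⊥
  ... | α , α∈Γ , T⊢¬α = inj₂ λ {β} β∈Δ →
    Wc.closed T-Wc β (modus-ponens T⊢¬α (assumption (Θ⊆T (I α β α∈Γ β∈Δ))))

  II⇒I : Closed _⊢_ Θ → CondII _⊢_ Γ Δ Θ → CondI _⊢_ Γ Δ Θ
  II⇒I {Θ} Θ-closed II α β α∈Γ β∈Δ = em⇒dne em ¬∉Θ
    where
    ¬∉Θ : ¬ ¬ (¬f α ⇒ β) ∈ Θ
    ¬∉Θ ∉Θ with prime-extension (∉Θ ∘ Θ-closed _ ∘ deduction)
    ... | T , T-Wc , Θ¬α⊆T , T⊬β with II T T-Wc (Θ¬α⊆T ∘ inj₁)
    ... | inj₁ Γ∪T⊬⊥ = Γ∪T⊬⊥ (modus-ponens (assumption (inj₁ α∈Γ)) (assumption (inj₂ (Θ¬α⊆T (inj₂ refl)))))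
    ... | inj₂ Δ⊆T   = T⊬β (assumption (Δ⊆T β∈Δ))

  II⇔III : CondII _⊢_ Γ Δ Θ ⇔ CondIII _⊢_ Γ Δ Θ
  II⇔III = mk⇔
    (λ II T T-Wc Θ⊆T → map₁ (Equivalence.to consistent⇔prime-extension) (II T T-Wc Θ⊆T))
    (λ III T T-Wc Θ⊆T → map₁ (Equivalence.from consistent⇔prime-extension) (III T T-Wc Θ⊆T))

lemma10 : ExcludedMiddle 0ℓ →
    (_⊢_ : Consequence) → Properties _⊢_ →
    (Γ Δ Θ : FSet) → Closed _⊢_ Γ → Closed _⊢_ Δ → Closed _⊢_ Θ →
    (CondI _⊢_ Γ Δ Θ ⇔ CondII _⊢_ Γ Δ Θ) × (CondII _⊢_ Γ Δ Θ ⇔ CondIII _⊢_ Γ Δ Θ)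
lemma10 em _⊢_ P Γ Δ Θ Γ-closed _ Θ-closed = mk⇔ (I⇒II Γ-closed) (II⇒I Θ-closed) , II⇔III
  where open Conditions em P
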